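{- Let $G=(V,E)$ be a finite simple undirected graph and let $m$ be an integer with $1 \leq m \leq |V|$. Then \[ k(G) \geq \min_{U \in \binom{V}{m}} \theta_E(E_G[U]; N_G[U]) - m + 1. \]
   Context: All graphs are finite, simple and undirected. The competition graph $C(D)$ of a digraph $D$ is the graph with vertex set $V(D)$ in which two distinct vertices $x,y$ are adjacent if and only if there is a vertex $v$ with $(x,v),(y,v)$ both arcs of $D$. The competition number $k(G)$ of a graph $G$ is the minimum nonnegative integer $k$ such that $G$ together with $k$ new isolated vertices is the competition graph of some acyclic digraph (a digraph with no directed cycles). A clique of $G$ is a set of vertices inducing a complete subgraph; an edge is covered by a clique if both endpoints lie in it. For $F \subseteq E(G)$, an edge clique cover of $F$ in $G$ is a family of cliques of $G$ such that every edge of $F$ is covered by some clique of the family, and $\theta_E(F;G)$ is the minimum size of such a family. For $U \subseteq V(G)$: $N_G[U]$ is the set $U$ together with all vertices adjacent to some vertex of $U$, and the same symbol denotes the subgraph of $G$ induced by this set; $E_G[U]$ is the set of edges of $G$ having at least one endpoint in $U$. $\binom{V}{m}$ denotes the set of all $m$-element subsets of $V$. -}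

module Defs where

open import Data.Nat using (ℕ; _+_)
open import Data.Fin using (Fin; splitAt)
open import Data.Fin.Subset using (Subset; _∈_; _⊆_)
open import Data.Sum using (_⊎_; inj₁; inj₂)
open import Data.Product using (_×_; ∃; ∃-syntax; Σ-syntax)
open import Data.Empty using (⊥)
open import Data.List using (List)
open import Data.List.Relation.Unary.All using (All)
open import Data.List.Relation.Unary.Any using (Any)
open import Relation.Nullary using (¬_; Dec)
open import Relation.Binary.PropositionalEquality using (_≡_)
open import Relation.Binary.Construct.Closure.Transitive using (TransClosure)
open import Function.Bundles using (_⇔_)

record Graph (n : ℕ) : Set₁ where
  field
    Adj    : Fin n → Fin n → Set
    sym    : ∀ {x y} → Adj x y → Adj y x
    irrefl : ∀ {x} → ¬ Adj x x
    dec    : ∀ x y → Dec (Adj x y)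
open Graph public

Digraph : ℕ → Set₁
Digraph N = Fin N → Fin N → Set

Acyclic : ∀ {N} → Digraph N → Set
Acyclic {N} D = ∀ (v : Fin N) → ¬ TransClosure D v v

CompAdj : ∀ {N} → Digraph N → Fin N → Fin N → Set
CompAdj {N} D x y = ∃[ v ] (D x v × D y v)

-- Adjacency of G together with k new isolated vertices (vertices Fin n ↦ old, rest new).
IsoAdj : ∀ {n} (G : Graph n) (k : ℕ) → Fin (n + k) → Fin (n + k) → Set
IsoAdj {n} G k x y with splitAt n x | splitAt n y
... | inj₁ x' | inj₁ y' = Adj G x' y'
... | _       | _       = ⊥

IsCompGraphOf : ∀ {n} (G : Graph n) (k : ℕ) → Digraph (n + k) → Set
IsCompGraphOf G k D = ∀ x y → ¬ x ≡ y → (IsoAdj G k x y ⇔ CompAdj D x y)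

Admissible : ∀ {n} (G : Graph n) (k : ℕ) → Set₁
Admissible {n} G k = Σ[ D ∈ Digraph (n + k) ] (Acyclic D × IsCompGraphOf G k D)

IsCompetitionNumber : ∀ {n} (G : Graph n) (k : ℕ) → Set₁
IsCompetitionNumber G k = Admissible G k × (∀ k' → Admissible G k' → k Data.Nat.≤ k')
  where import Data.Nat

InN : ∀ {n} (G : Graph n) (U : Subset n) → Fin n → Set
InN G U x = x ∈ U ⊎ ∃[ u ] (u ∈ U × Adj G x u)

IsCliqueOfN : ∀ {n} (G : Graph n) (U : Subset n) → Subset n → Set
IsCliqueOfN G U C =
  (∀ x → x ∈ C → InN G U x) × (∀ x y → x ∈ C → y ∈ C → ¬ x ≡ y → Adj G x y)

InEU : ∀ {n} (G : Graph n) (U : Subset n) → Fin n → Fin n → Set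
InEU G U x y = Adj G x y × (x ∈ U ⊎ y ∈ U)

IsECC : ∀ {n} (G : Graph n) (U : Subset n) → List (Subset n) → Set
IsECC G U 𝓒 =
  All (IsCliqueOfN G U) 𝓒 ×
  (∀ x y → InEU G U x y → Any (λ C → x ∈ C × y ∈ C) 𝓒)

IsThetaE : ∀ {n} (G : Graph n) (U : Subset n) → ℕ → Set
IsThetaE G U t =
  (∃[ 𝓒 ] (IsECC G U 𝓒 × Data.List.length 𝓒 ≡ t)) ×
  (∀ 𝓒 → IsECC G U 𝓒 → t Data.Nat.≤ Data.List.length 𝓒)
  where import Data.Nat; import Data.List

module Submission where

-- Let D be an acyclic digraph on the vertices of G plus k isolated vertices,
-- with C(D) = G ∪ I_k.  Call a vertex set T out-closed if every arc leaving a
-- vertex of T ends in T.  In an acyclic digraph every nonempty set T has a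
-- source (a vertex of T with no in-arc from T), and deleting a source from an
-- out-closed set keeps it out-closed while removing at most one vertex of G.
-- Starting from the whole vertex set and deleting sources one by one we reach
-- an out-closed T containing exactly m vertices of G; let U be these vertices
-- and u a source of T.  For every w ∈ T − u the in-neighbours of w inside
-- N_G[U] form a clique of G, and every edge xy of E_G[U] has a common
-- out-neighbour w which lies in T (out-closure) and differs from u (u is a
-- source); so these |T| − 1 ≤ m + k − 1 cliques cover E_G[U].

open import Defs hiding (sym)
open import Data.Nat using (ℕ; _+_; _∸_; _≤_)
open import Data.Fin.Subset using (Subset; ∣_∣)
open import Data.Product using (_×_; Σ-syntax; ∃-syntax)
open import Relation.Binary.PropositionalEquality using (_≡_)

open import Data.Nat using (zero; suc; pred; _<_; z≤n; s≤s; s≤s⁻¹)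
open import Data.Nat.Properties
  using (≤-trans; ≤-refl; ≤-reflexive; ≤∧≢⇒<; ≮⇒≥; <⇒≤pred;
         pred[m∸n]≡m∸[1+n]; +-comm; +-suc)
import Data.Nat.Properties as ℕ
open import Data.Bool using (true; false)
open import Data.Fin as Fin using (Fin; _↑ˡ_)
open import Data.Fin.Properties using (splitAt-↑ˡ; ↑ˡ-injective; any?; all?)
open import Data.Fin.Subset using (_∈_; _⊆_; _-_; _∩_; _∪_; ⁅_⁆; ⊤; ⊥; Nonempty; inside)
open import Data.Fin.Subset.Properties
  using (_∈?_; anySubset?; nonempty?; Empty-unique; ∣⊥∣≡0; ∣⊤∣≡n; ∣p∣≤n;
         x∈p⇒∣p-x∣<∣p∣; x∈p∧x≢y⇒x∈p-y; p─q⊆p; ∈⊤; ∩-zeroʳ; ∣p∩q∣≤∣p∣;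
         x∈⁅x⁆; ∣⁅x⁆∣≡1; x∈p∪q⁺; x∈p∩q⁺; x∈p∩q⁻; p⊆q⇒∣p∣≤∣q∣)
open import Data.Product using (_,_; proj₁; proj₂; ∃)
open import Data.Sum using (_⊎_; inj₁; inj₂; [_,_]′)
open import Data.List using (List; []; _∷_; length; map)
open import Data.List.Properties using (length-map)
open import Data.List.Relation.Unary.All as All using (All)
open import Data.List.Relation.Unary.All.Properties as All using ()
open import Data.List.Relation.Unary.Any as Any using (Any; here; there)
open import Data.List.Relation.Unary.Any.Properties as Any using ()
open import Data.List.Membership.Propositional as ListMembership using (lose)
open import Data.List.Membership.Propositional.Properties using (∈-map⁺)
open import Data.Vec using (_∷_; []; tabulate; here; there)
open import Data.Vec.Properties using (lookup∘tabulate; []=⇒lookup; lookup⇒[]=)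
open import Relation.Nullary using (¬_; Dec; yes; no; does)
open import Relation.Nullary.Decidable
  using (_×-dec_; _⊎-dec_; _→-dec_; ¬?; map′; dec-true; decidable-stable; ¬¬-excluded-middle)
open import Relation.Nullary.Negation using (contradiction; ¬¬-map)
open import Relation.Binary.PropositionalEquality using (refl; sym; trans; cong; subst)
open import Relation.Binary.Construct.Closure.Transitive using (TransClosure; [_]; _∷_; _∷ʳ_)
open import Function.Bundles using (Equivalence)

∣p∪q∣≤∣p∣+∣q∣ : ∀ {N} (p q : Subset N) → ∣ p ∪ q ∣ ≤ ∣ p ∣ + ∣ q ∣
∣p∪q∣≤∣p∣+∣q∣ []          []          = z≤n
∣p∪q∣≤∣p∣+∣q∣ (true  ∷ p) (true  ∷ q) =
  s≤s (≤-trans (∣p∪q∣≤∣p∣+∣q∣ p q) (ℕ.+-monoʳ-≤ ∣ p ∣ (ℕ.n≤1+n ∣ q ∣)))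
∣p∪q∣≤∣p∣+∣q∣ (true  ∷ p) (false ∷ q) = s≤s (∣p∪q∣≤∣p∣+∣q∣ p q)
∣p∪q∣≤∣p∣+∣q∣ (false ∷ p) (true  ∷ q) =
  ≤-trans (s≤s (∣p∪q∣≤∣p∣+∣q∣ p q)) (≤-reflexive (sym (+-suc ∣ p ∣ ∣ q ∣)))
∣p∪q∣≤∣p∣+∣q∣ (false ∷ p) (false ∷ q) = ∣p∪q∣≤∣p∣+∣q∣ p q

∣T∩O∣-remove : ∀ {N} (T O : Subset N) u → ∣ T ∩ O ∣ ≤ suc ∣ (T - u) ∩ O ∣
∣T∩O∣-remove T O u = begin
  ∣ T ∩ O ∣                   ≤⟨ p⊆q⇒∣p∣≤∣q∣ covered ⟩
  ∣ ((T - u) ∩ O) ∪ ⁅ u ⁆ ∣   ≤⟨ ∣p∪q∣≤∣p∣+∣q∣ ((T - u) ∩ O) ⁅ u ⁆ ⟩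
  ∣ (T - u) ∩ O ∣ + ∣ ⁅ u ⁆ ∣  ≡⟨ cong (∣ (T - u) ∩ O ∣ +_) (∣⁅x⁆∣≡1 u) ⟩
  ∣ (T - u) ∩ O ∣ + 1         ≡⟨ +-comm _ 1 ⟩
  suc ∣ (T - u) ∩ O ∣         ∎
  where
  open ℕ.≤-Reasoning
  covered : T ∩ O ⊆ ((T - u) ∩ O) ∪ ⁅ u ⁆
  covered {y} y∈T∩O with x∈p∩q⁻ T O y∈T∩O | y Fin.≟ u
  ... | _ , _     | yes refl = x∈p∪q⁺ (inj₂ (x∈⁅x⁆ u))
  ... | y∈T , y∈O | no y≢u   = x∈p∪q⁺ (inj₁ (x∈p∩q⁺ (x∈p∧x≢y⇒x∈p-y y∈T y≢u , y∈O)))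

nonempty-of-size : ∀ {N} (p : Subset N) → 0 < ∣ p ∣ → Nonempty p
nonempty-of-size {N} p 0<∣p∣ with nonempty? p
... | yes ne = ne
... | no ¬ne = contradiction (trans (cong ∣_∣ (Empty-unique ¬ne)) (∣⊥∣≡0 N)) (ℕ.>⇒≢ 0<∣p∣)

select : ∀ {N} {P : Fin N → Set} → (∀ x → Dec (P x)) → Subset N
select P? = tabulate (λ x → does (P? x))

∈-select⁺ : ∀ {N} {P : Fin N → Set} (P? : ∀ x → Dec (P x)) {x} → P x → x ∈ select P?
∈-select⁺ P? {x} px = lookup⇒[]= x _ (trans (lookup∘tabulate _ x) (dec-true (P? x) px))

∈-select⁻ : ∀ {N} {P : Fin N → Set} (P? : ∀ x → Dec (P x)) {x} → x ∈ select P? → P x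
∈-select⁻ P? {x} x∈ with P? x | trans (sym (lookup∘tabulate (λ z → does (P? z)) x)) ([]=⇒lookup x∈)
... | yes px | _ = px
... | no _   | ()

members : ∀ {N} → Subset N → List (Fin N)
members []          = []
members (true  ∷ p) = Fin.zero ∷ map Fin.suc (members p)
members (false ∷ p) = map Fin.suc (members p)

length-members : ∀ {N} (p : Subset N) → length (members p) ≡ ∣ p ∣
length-members []          = refl
length-members (true  ∷ p) = cong suc (trans (length-map Fin.suc (members p)) (length-members p))
length-members (false ∷ p) = trans (length-map Fin.suc (members p)) (length-members p)

∈-members : ∀ {N} {p : Subset N} {x} → x ∈ p → x ListMembership.∈ members p
∈-members {p = true ∷ p} here         = here refl
∈-members {p = true ∷ p} (there x∈p)  = there (∈-map⁺ Fin.suc (∈-members x∈p))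
∈-members {p = false ∷ p} (there x∈p) = ∈-map⁺ Fin.suc (∈-members x∈p)

Searchable : Set → Set₁
Searchable A = ∀ {P : A → Set} → (∀ x → Dec (P x)) → Dec (∃ P)

search-bounded : ∀ {A : Set} → Searchable A → {P : List A → Set} → (∀ xs → Dec (P xs)) →
                 ∀ L → Dec (Σ[ xs ∈ List A ] (length xs ≤ L × P xs))
search-bounded search P? zero =
  map′ (λ p → [] , z≤n , p) (λ { ([] , _ , p) → p }) (P? [])
search-bounded search {P} P? (suc L) =
  map′ to from (P? [] ⊎-dec search (λ a → search-bounded search (λ xs → P? (a ∷ xs)) L))
  where
  to : P [] ⊎ ∃ (λ a → Σ[ xs ∈ _ ] (length xs ≤ L × P (a ∷ xs))) →
       Σ[ xs ∈ _ ] (length xs ≤ suc L × P xs)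
  to (inj₁ p)                = [] , z≤n , p
  to (inj₂ (a , xs , le , p)) = a ∷ xs , s≤s le , p
  from : Σ[ xs ∈ _ ] (length xs ≤ suc L × P xs) →
         P [] ⊎ ∃ (λ a → Σ[ xs ∈ _ ] (length xs ≤ L × P (a ∷ xs)))
  from ([] , _ , p)           = inj₁ p
  from (a ∷ xs , s≤s le , p)  = inj₂ (a , xs , le , p)

least-witness : (R : ℕ → Set) → (∀ i → Dec (R i)) → ∀ j → R j →
                Σ[ t ∈ ℕ ] (R t × t ≤ j × (∀ i → i < t → ¬ R i))
least-witness R R? zero r = 0 , r , z≤n , λ _ ()
least-witness R R? (suc j) r with R? 0
... | yes r₀ = 0 , r₀ , z≤n , λ _ ()
... | no ¬r₀ with least-witness (λ i → R (suc i)) (λ i → R? (suc i)) j r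
... | t , rt , t≤j , below =
  suc t , rt , s≤s t≤j , λ { zero _ → ¬r₀ ; (suc i) i<t → below i (s≤s⁻¹ i<t) }

¬¬-∀-Fin : ∀ {N} {R : Fin N → Set} → (∀ i → ¬ ¬ R i) → ¬ ¬ (∀ i → R i)
¬¬-∀-Fin {zero}  h k = k (λ ())
¬¬-∀-Fin {suc N} {R} h k =
  h Fin.zero (λ r₀ → ¬¬-∀-Fin {N} {λ i → R (Fin.suc i)} (λ i → h (Fin.suc i))
    (λ rs → k (λ { Fin.zero → r₀ ; (Fin.suc i) → rs i })))

¬¬-decidable : ∀ {N} (D : Digraph N) → ¬ ¬ (∀ x y → Dec (D x y))
¬¬-decidable D = ¬¬-∀-Fin (λ x → ¬¬-∀-Fin (λ y → ¬¬-excluded-middle))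

module AcyclicDigraph {N : ℕ} (D : Digraph N) (D? : ∀ x y → Dec (D x y))
                      (acyclic : Acyclic D) where

  OutClosed : Subset N → Set
  OutClosed T = ∀ a b → D a b → a ∈ T → b ∈ T

  Source : Subset N → Fin N → Set
  Source T u = u ∈ T × (∀ a → a ∈ T → ¬ D a u)

  -- A source of T − x reaching a predecessor a of x is a source of T reaching x:
  -- an arc x → u would close a directed cycle through x.
  lift-source : ∀ {T x a u} → D a x → Source (T - x) u →
                (u ≡ a ⊎ TransClosure D u a) → Source T u × TransClosure D u x
  lift-source {T} {x} {u = u} Dax (u∈T-x , no-arc-in) reach =
    (p─q⊆p T ⁅ x ⁆ u∈T-x , no-arc-in′) , path
    where
    path : TransClosure D u x
    path = [ (λ u≡a → subst (λ z → TransClosure D z x) (sym u≡a) [ Dax ]) , (_∷ʳ Dax) ]′ reach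
    no-arc-in′ : ∀ b → b ∈ T → ¬ D b u
    no-arc-in′ b b∈T Dbu with b Fin.≟ x
    ... | yes refl = acyclic b (Dbu ∷ path)
    ... | no b≢x   = no-arc-in b (x∈p∧x≢y⇒x∈p-y b∈T b≢x) Dbu

  source-above : ∀ s T x → ∣ T ∣ ≤ s → x ∈ T →
                 Σ[ u ∈ Fin N ] (Source T u × (u ≡ x ⊎ TransClosure D u x))
  source-above zero T x ∣T∣≤0 x∈T = contradiction (≤-trans (x∈p⇒∣p-x∣<∣p∣ x∈T) ∣T∣≤0) λ ()
  source-above (suc s) T x ∣T∣≤s x∈T with any? (λ a → (a ∈? T) ×-dec D? a x)
  ... | no no-pred = x , (x∈T , λ a a∈T Dax → no-pred (a , a∈T , Dax)) , inj₁ refl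
  ... | yes (a , a∈T , Dax) with source-above s (T - x) a ∣T-x∣≤s a∈T-x
    where
    ∣T-x∣≤s : ∣ T - x ∣ ≤ s
    ∣T-x∣≤s = s≤s⁻¹ (≤-trans (x∈p⇒∣p-x∣<∣p∣ x∈T) ∣T∣≤s)
    a∈T-x : a ∈ T - x
    a∈T-x = x∈p∧x≢y⇒x∈p-y a∈T (λ { refl → acyclic a [ Dax ] })
  ... | u , src , reach with lift-source Dax src reach
  ... | src′ , path = u , src′ , inj₂ path

  source-exists : ∀ T → Nonempty T → ∃ (Source T)
  source-exists T (x , x∈T) with source-above ∣ T ∣ T x ≤-refl x∈T
  ... | u , src , _ = u , src

  remove-source : ∀ {T u} → OutClosed T → Source T u → OutClosed (T - u)
  remove-source {T} {u} closed (_ , no-arc-in) a b Dab a∈T-u =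
    x∈p∧x≢y⇒x∈p-y (closed a b Dab a∈T) (λ { refl → no-arc-in a a∈T Dab })
    where
    a∈T : a ∈ T
    a∈T = p─q⊆p T ⁅ u ⁆ a∈T-u

  shrink : ∀ (O : Subset N) {m} → 1 ≤ m → ∀ s T → ∣ T ∣ ≤ s → OutClosed T → m ≤ ∣ T ∩ O ∣ →
           Σ[ T′ ∈ Subset N ] (OutClosed T′ × ∣ T′ ∩ O ∣ ≡ m)
  shrink O 1≤m zero T ∣T∣≤0 closed m≤∣T∩O∣ =
    contradiction (≤-trans 1≤m (≤-trans m≤∣T∩O∣ (≤-trans (∣p∩q∣≤∣p∣ T O) ∣T∣≤0))) λ ()
  shrink O {m} 1≤m (suc s) T ∣T∣≤s closed m≤∣T∩O∣ with m ℕ.≟ ∣ T ∩ O ∣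
  ... | yes m≡∣T∩O∣ = T , closed , sym m≡∣T∩O∣
  ... | no m≢∣T∩O∣
    with source-exists T (nonempty-of-size T (≤-trans 1≤m (≤-trans m≤∣T∩O∣ (∣p∩q∣≤∣p∣ T O))))
  ... | u , src@(u∈T , _) =
    shrink O 1≤m s (T - u)
      (s≤s⁻¹ (≤-trans (x∈p⇒∣p-x∣<∣p∣ u∈T) ∣T∣≤s))
      (remove-source closed src)
      (s≤s⁻¹ (≤-trans (≤∧≢⇒< m≤∣T∩O∣ m≢∣T∩O∣) (∣T∩O∣-remove T O u)))

-- In Fin (n + k) the first n vertices are those of G, the last k the isolated
-- ones; oldPart n T is the set of vertices of G lying in T ⊆ Fin (n + k).
oldPart : ∀ n {k} → Subset (n + k) → Subset n
oldPart zero    T       = []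
oldPart (suc n) (b ∷ T) = b ∷ oldPart n T

∈-oldPart⁻ : ∀ n {k} {T : Subset (n + k)} {x} → x ∈ oldPart n T → x ↑ˡ k ∈ T
∈-oldPart⁻ (suc n) {T = _ ∷ T} here       = here
∈-oldPart⁻ (suc n) {T = _ ∷ T} (there x∈) = there (∈-oldPart⁻ n x∈)

old : ∀ n k → Subset (n + k)
old zero    k = ⊥
old (suc n) k = inside ∷ old n k

∣oldPart∣≡∣T∩old∣ : ∀ n {k} (T : Subset (n + k)) → ∣ oldPart n T ∣ ≡ ∣ T ∩ old n k ∣
∣oldPart∣≡∣T∩old∣ zero    {k} T = sym (trans (cong ∣_∣ (∩-zeroʳ T)) (∣⊥∣≡0 k))
∣oldPart∣≡∣T∩old∣ (suc n) (true  ∷ T) = cong suc (∣oldPart∣≡∣T∩old∣ n T)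
∣oldPart∣≡∣T∩old∣ (suc n) (false ∷ T) = ∣oldPart∣≡∣T∩old∣ n T

∣T∣≤∣oldPart∣+k : ∀ n {k} (T : Subset (n + k)) → ∣ T ∣ ≤ ∣ oldPart n T ∣ + k
∣T∣≤∣oldPart∣+k zero    T           = ∣p∣≤n T
∣T∣≤∣oldPart∣+k (suc n) (true  ∷ T) = s≤s (∣T∣≤∣oldPart∣+k n T)
∣T∣≤∣oldPart∣+k (suc n) (false ∷ T) = ∣T∣≤∣oldPart∣+k n T

∣oldPart⊤∣ : ∀ n {k} → ∣ oldPart n (⊤ {n + k}) ∣ ≡ n
∣oldPart⊤∣ n {k} = trans (cong ∣_∣ (oldPart⊤ n)) (∣⊤∣≡n n)
  where
  oldPart⊤ : ∀ n → oldPart n (⊤ {n + k}) ≡ ⊤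
  oldPart⊤ zero    = refl
  oldPart⊤ (suc n) = cong (inside ∷_) (oldPart⊤ n)

old-adjacency : ∀ {n} (G : Graph n) k (x y : Fin n) →
                IsoAdj G k (x ↑ˡ k) (y ↑ˡ k) ≡ Adj G x y
old-adjacency {n} G k x y rewrite splitAt-↑ˡ n x k | splitAt-↑ˡ n y k = refl

module _ {n : ℕ} (G : Graph n) where

  InN? : ∀ U x → Dec (InN G U x)
  InN? U x = (x ∈? U) ⊎-dec any? (λ u → (u ∈? U) ×-dec dec G x u)

  clique? : ∀ U C → Dec (IsCliqueOfN G U C)
  clique? U C =
    all? (λ x → (x ∈? C) →-dec InN? U x) ×-dec
    all? (λ x → all? (λ y → (x ∈? C) →-dec ((y ∈? C) →-dec (¬? (x Fin.≟ y) →-dec dec G x y))))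

  ECC? : ∀ U 𝓒 → Dec (IsECC G U 𝓒)
  ECC? U 𝓒 =
    All.all? (clique? U) 𝓒 ×-dec
    all? (λ x → all? (λ y → (dec G x y ×-dec ((x ∈? U) ⊎-dec (y ∈? U))) →-dec
      Any.any? (λ C → (x ∈? C) ×-dec (y ∈? C)) 𝓒))

  ends-in-N : ∀ {U x y} → InEU G U x y → InN G U x × InN G U y
  ends-in-N {x = x} {y} (xy , inj₁ x∈U) = inj₁ x∈U , inj₂ (x , x∈U , Graph.sym G xy)
  ends-in-N {x = x} {y} (xy , inj₂ y∈U) = inj₂ (y , y∈U , xy) , inj₁ y∈U

  SmallCover : Subset n → ℕ → Set
  SmallCover U L = Σ[ 𝓒 ∈ List (Subset n) ] (length 𝓒 ≤ L × IsECC G U 𝓒)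

  small-cover? : ∀ U L → Dec (SmallCover U L)
  small-cover? U = search-bounded anySubset? (ECC? U)

  small-cover-exists? : ∀ m L → Dec (Σ[ U ∈ Subset n ] (∣ U ∣ ≡ m × SmallCover U L))
  small-cover-exists? m L = anySubset? (λ U → (∣ U ∣ ℕ.≟ m) ×-dec small-cover? U L)

  theta-exists : ∀ U L → SmallCover U L → ∃[ t ] (IsThetaE G U t × t ≤ L)
  theta-exists U L cover with least-witness (SmallCover U) (small-cover? U) L cover
  ... | t , (𝓒 , ∣𝓒∣≤t , ecc) , t≤L , below =
    length 𝓒 , ((𝓒 , ecc , refl) , minimal) , ≤-trans ∣𝓒∣≤t t≤L
    where
    minimal : ∀ 𝓒′ → IsECC G U 𝓒′ → length 𝓒 ≤ length 𝓒′
    minimal 𝓒′ ecc′ = ≤-trans ∣𝓒∣≤t (≮⇒≥ (λ lt → below _ lt (𝓒′ , ≤-refl , ecc′)))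

module Competition {n k : ℕ} (G : Graph n) (D : Digraph (n + k)) (acyclic : Acyclic D)
                   (comp : IsCompGraphOf G k D) (D? : ∀ x y → Dec (D x y)) where

  open AcyclicDigraph D D? acyclic

  ↑ˡ-≢ : ∀ {x y : Fin n} → ¬ x ≡ y → ¬ x ↑ˡ k ≡ y ↑ˡ k
  ↑ˡ-≢ {x} {y} x≢y eq = x≢y (↑ˡ-injective k x y eq)

  common-prey : ∀ {x y} → Adj G x y → ∃[ v ] (D (x ↑ˡ k) v × D (y ↑ˡ k) v)
  common-prey {x} {y} xy =
    Equivalence.to (comp (x ↑ˡ k) (y ↑ˡ k) (↑ˡ-≢ x≢y))
      (subst (λ A → A) (sym (old-adjacency G k x y)) xy)
    where
    x≢y : ¬ x ≡ y
    x≢y refl = irrefl G xy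

  prey-adjacent : ∀ {x y w} → ¬ x ≡ y → D (x ↑ˡ k) w → D (y ↑ˡ k) w → Adj G x y
  prey-adjacent {x} {y} {w} x≢y Dxw Dyw =
    subst (λ A → A) (old-adjacency G k x y)
      (Equivalence.from (comp (x ↑ˡ k) (y ↑ˡ k) (↑ˡ-≢ x≢y)) (w , Dxw , Dyw))

  module Cover (T : Subset (n + k)) (closed : OutClosed T) (u : Fin (n + k))
               (source : Source T u) where

    U : Subset n
    U = oldPart n T

    preys? : ∀ w x → Dec (D (x ↑ˡ k) w × InN G U x)
    preys? w x = D? (x ↑ˡ k) w ×-dec InN? G U x

    preyClique : Fin (n + k) → Subset n
    preyClique w = select (preys? w)

    preyClique-isClique : ∀ w → IsCliqueOfN G U (preyClique w)
    preyClique-isClique w =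
      (λ x x∈ → proj₂ (∈-select⁻ (preys? w) x∈)) ,
      (λ x y x∈ y∈ x≢y → prey-adjacent x≢y (proj₁ (∈-select⁻ (preys? w) x∈))
                                           (proj₁ (∈-select⁻ (preys? w) y∈)))

    cover : List (Subset n)
    cover = map preyClique (members (T - u))

    length-cover : length cover ≡ ∣ T - u ∣
    length-cover = trans (length-map preyClique (members (T - u))) (length-members (T - u))

    length-cover≤ : ∀ {m} → ∣ U ∣ ≡ m → length cover ≤ k + m ∸ 1
    length-cover≤ {m} ∣U∣≡m = begin
      length cover      ≡⟨ length-cover ⟩
      ∣ T - u ∣         ≤⟨ <⇒≤pred (≤-trans (x∈p⇒∣p-x∣<∣p∣ (proj₁ source)) (∣T∣≤∣oldPart∣+k n T)) ⟩
      pred (∣ U ∣ + k)  ≡⟨ cong (λ i → pred (i + k)) ∣U∣≡m ⟩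
      pred (m + k)      ≡⟨ pred[m∸n]≡m∸[1+n] (m + k) 0 ⟩
      m + k ∸ 1         ≡⟨ cong (_∸ 1) (+-comm m k) ⟩
      k + m ∸ 1         ∎
      where open ℕ.≤-Reasoning

    -- A prey of a vertex of U lies in T (out-closure) and is not u (u is a source).
    prey-in-T-u : ∀ {z v} → z ∈ U → D (z ↑ˡ k) v → v ∈ T - u
    prey-in-T-u {z} z∈U Dzv =
      x∈p∧x≢y⇒x∈p-y (closed _ _ Dzv z∈T) (λ { refl → proj₂ source _ z∈T Dzv })
      where
      z∈T : z ↑ˡ k ∈ T
      z∈T = ∈-oldPart⁻ n z∈U

    covers : ∀ x y → InEU G U x y → Any (λ C → x ∈ C × y ∈ C) cover
    covers x y edge@(xy , side) with common-prey xy | ends-in-N G edge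
    ... | v , Dxv , Dyv | x∈N , y∈N =
      Any.map⁺ (lose (∈-members v∈T-u)
        (∈-select⁺ (preys? v) (Dxv , x∈N) , ∈-select⁺ (preys? v) (Dyv , y∈N)))
      where
      v∈T-u : v ∈ T - u
      v∈T-u = [ (λ x∈U → prey-in-T-u x∈U Dxv) , (λ y∈U → prey-in-T-u y∈U Dyv) ]′ side

    isECC : IsECC G U cover
    isECC = All.map⁺ (All.universal (λ w → preyClique-isClique w) (members (T - u))) , covers

  out-closed-with-m : ∀ m → 1 ≤ m → m ≤ n →
                      Σ[ T ∈ Subset (n + k) ] (OutClosed T × ∣ oldPart n T ∣ ≡ m)
  out-closed-with-m m 1≤m m≤n
    with shrink (old n k) 1≤m ∣ ⊤ {n + k} ∣ ⊤ ≤-refl (λ _ _ _ _ → ∈⊤) m≤∣⊤∩old∣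
    where
    m≤∣⊤∩old∣ : m ≤ ∣ ⊤ ∩ old n k ∣
    m≤∣⊤∩old∣ = subst (m ≤_) (trans (sym (∣oldPart⊤∣ n)) (∣oldPart∣≡∣T∩old∣ n ⊤)) m≤n
  ... | T , closed , ∣T∩old∣≡m = T , closed , trans (∣oldPart∣≡∣T∩old∣ n T) ∣T∩old∣≡m

  small-cover : ∀ m → 1 ≤ m → m ≤ n →
                Σ[ U ∈ Subset n ] (∣ U ∣ ≡ m × SmallCover G U (k + m ∸ 1))
  small-cover m 1≤m m≤n with out-closed-with-m m 1≤m m≤n
  ... | T , closed , ∣U∣≡m with source-exists T (nonempty-of-size T 0<∣T∣)
    where
    0<∣T∣ : 0 < ∣ T ∣
    0<∣T∣ = ≤-trans 1≤m (≤-trans (≤-reflexive (sym ∣U∣≡m))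
              (≤-trans (≤-reflexive (∣oldPart∣≡∣T∩old∣ n T)) (∣p∩q∣≤∣p∣ T (old n k))))
  ... | u , src = U , ∣U∣≡m , cover , length-cover≤ ∣U∣≡m , isECC
    where open Cover T closed u src

-- The conclusion is decidable, so the double negation of decidability of the
-- arcs of D suffices.
lemma4 : ∀ (n : ℕ) (G : Graph n) (m : ℕ) → 1 ≤ m → m ≤ n →
    ∀ (k : ℕ) → IsCompetitionNumber G k →
    Σ[ U ∈ Subset n ] (∣ U ∣ ≡ m × ∃[ t ] (IsThetaE G U t × t ≤ k + m ∸ 1))
lemma4 n G m 1≤m m≤n k ((D , acyclic , comp) , _)
  with decidable-stable (small-cover-exists? G m (k + m ∸ 1))
         (¬¬-map (λ D? → Competition.small-cover G D acyclic comp D? m 1≤m m≤n) (¬¬-decidable D))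
... | U , ∣U∣≡m , cover = U , ∣U∣≡m , theta-exists G U (k + m ∸ 1) cover
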